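{- Let $\alpha<\beta<\gamma$ be distinct primes, let $G=\langle a\rangle$ be a cyclic group of order $\alpha^2\beta^2\gamma^2$, and let $C=\{x\in G : |x|\in\{\alpha^2,\beta^2,\gamma^2\}\}$. Let $Cay_{p^2}(G,C)$ be the simple undirected graph with vertex set $G$ in which two distinct vertices $x,y$ are adjacent if and only if $xy^{ -1}\in C$. Then the chromatic number of $Cay_{p^2}(G,C)$ is $\gamma$.
   Context: $|x|$ denotes the order of the element $x$ in $G$. -}

module Defs where

open import Level using (Level; _⊔_)
open import Algebra.Bundles using (Group)
open import Data.Nat using (ℕ; zero; suc; _<_; _*_)
open import Data.Fin using (Fin)
open import Data.Product using (_×_; ∃)
open import Data.Sum using (_⊎_)
open import Relation.Nullary using (¬_)
open import Relation.Binary.PropositionalEquality using (_≡_)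

module _ {c ℓ : Level} (G : Group c ℓ) where
  open Group G

  pow : Carrier → ℕ → Carrier
  pow x zero    = ε
  pow x (suc n) = x ∙ pow x n

  HasOrder : Carrier → ℕ → Set ℓ
  HasOrder x m = (0 < m) × (pow x m ≈ ε) × (∀ k → 0 < k → k < m → ¬ (pow x k ≈ ε))

  IsCyclicOfOrderWithGenerator : Carrier → ℕ → Set (c ⊔ ℓ)
  IsCyclicOfOrderWithGenerator a n = HasOrder a n × (∀ x → ∃ λ k → x ≈ pow a k)

  InC : ℕ → ℕ → ℕ → Carrier → Set ℓ
  InC α β γ x = HasOrder x (α * α) ⊎ HasOrder x (β * β) ⊎ HasOrder x (γ * γ)

  Adj : ℕ → ℕ → ℕ → Carrier → Carrier → Set ℓ
  Adj α β γ x y = ¬ (x ≈ y) × InC α β γ (x ∙ y ⁻¹)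

  -- a proper k-colouring of Cay(G, C) (a function on vertices, i.e. respecting ≈)
  ProperColouring : ℕ → ℕ → ℕ → (k : ℕ) → (Carrier → Fin k) → Set (c ⊔ ℓ)
  ProperColouring α β γ k col =
    (∀ x y → x ≈ y → col x ≡ col y) ×
    (∀ x y → Adj α β γ x y → ¬ (col x ≡ col y))

  Colourable : ℕ → ℕ → ℕ → ℕ → Set (c ⊔ ℓ)
  Colourable α β γ k = ∃ λ (col : Carrier → Fin k) → ProperColouring α β γ k col

  ChromaticNumberIs : ℕ → ℕ → ℕ → ℕ → Set (c ⊔ ℓ)
  ChromaticNumberIs α β γ χ = Colourable α β γ χ × (∀ k → k < χ → ¬ Colourable α β γ k)

-- Write vertices as powers a^k and colour a^k by (k mod α + k mod β + k mod γ) mod γ.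
-- If x y⁻¹ = a^d has order p² for p ∈ {α, β, γ}, then d is divisible by the two other
-- primes but not by p, so the exponents of x and y have the same residues except modulo p,
-- where they differ by less than p ≤ γ; hence the colours differ.  Conversely, the powers
-- of a^(α²β²) with exponents 0, …, γ - 1 differ pairwise by elements of order γ², so they
-- form a clique of size γ.
{-# OPTIONS --safe #-}
module Submission where

open import Defs
open import Level using (Level)
open import Algebra.Bundles using (Group)
open import Data.Nat using (ℕ; _<_; _*_)
open import Data.Nat.Primality using (Prime)

import Algebra.Properties.CommutativeSemigroup as CommSemigroupProperties
open import Data.Nat.Base
  using (zero; suc; _+_; _∸_; _≤_; _%_; _/_; z<s; NonZero; NonTrivial; >-nonZero; >-nonZero⁻¹; nonTrivial⇒n>1)
open import Data.Nat.Properties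
open import Data.Nat.DivMod using (m≡m%n+[m/n]*n; m%n<n; m<n⇒m%n≡m; m∣n⇒o%n%m≡o%m; %-remove-+ˡ)
open import Data.Nat.Divisibility
open import Data.Nat.Coprimality as Coprimality using (Coprime; coprime-divisor; prime⇒coprime)
open import Data.Nat.Primality using (prime⇒nonZero; prime⇒nonTrivial)
open import Data.Fin as Fin using (Fin; toℕ; fromℕ<)
open import Data.Fin.Properties using (pigeonhole; fromℕ<-injective; toℕ<n)
open import Data.Product using (_×_; _,_; proj₁; proj₂)
open import Data.Sum as Sum using (_⊎_; inj₁; inj₂)
open import Function using (_∘_)
open import Relation.Nullary using (¬_)
open import Relation.Binary.PropositionalEquality as ≡ using (_≡_; _≢_; cong; cong₂; subst; subst₂)
import Relation.Binary.Reasoning.Setoid as SetoidReasoning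

private
  module +-Props = CommSemigroupProperties +-commutativeSemigroup
  module *-Props = CommSemigroupProperties *-commutativeSemigroup

coprime-*ʳ : ∀ {m n o} → Coprime m n → Coprime m o → Coprime m (n * o)
coprime-*ʳ m⊥n m⊥o (d∣m , d∣no) =
  m⊥o (d∣m , coprime-divisor (λ (e∣d , e∣n) → m⊥n (∣-trans e∣d d∣m , e∣n)) d∣no)

coprime-squares : ∀ {p q r} → Coprime p q → Coprime p r → Coprime p (q * q * (r * r))
coprime-squares p⊥q p⊥r = coprime-*ʳ (coprime-*ʳ p⊥q p⊥q) (coprime-*ʳ p⊥r p⊥r)

prime⇒coprime-square : ∀ {p n} → Prime p → .{{_ : NonZero n}} → n < p → Coprime (p * p) n
prime⇒coprime-square {p} {n} p-prime n<p = Coprimality.sym (coprime-*ʳ n⊥p n⊥p)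
  where
  n⊥p : Coprime n p
  n⊥p = Coprimality.sym (prime⇒coprime p-prime n<p)

coprime∧∣∧∣⇒*∣ : ∀ {m n d} → Coprime m n → m ∣ d → n ∣ d → m * n ∣ d
coprime∧∣∧∣⇒*∣ {m} {n} m⊥n (divides q ≡.refl) n∣qm =
  subst (m * n ∣_) (*-comm m q)
    (*-monoʳ-∣ m (coprime-divisor (Coprimality.sym m⊥n) (subst (n ∣_) (*-comm q m) n∣qm)))

square-factors∣ : ∀ {q r d} → q * q * (r * r) ∣ d → q ∣ d × r ∣ d
square-factors∣ {q} {r} qqrr∣d =
  m*n∣⇒m∣ q q (m*n∣⇒m∣ (q * q) (r * r) qqrr∣d) , m*n∣⇒m∣ r r (m*n∣⇒n∣ (q * q) (r * r) qqrr∣d)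

module _ {p : ℕ} .{{_ : NonZero p}} where
  open ≡.≡-Reasoning

  ∣∧<⇒≡0 : ∀ {m} → p ∣ m → m < p → m ≡ 0
  ∣∧<⇒≡0 {m} p∣m m<p = ≡.trans (≡.sym (m<n⇒m%n≡m m<p)) (n∣m⇒m%n≡0 m p p∣m)

  %≡⇒∣∸ : ∀ m n → m % p ≡ n % p → p ∣ m ∸ n
  %≡⇒∣∸ m n eq = subst (p ∣_) (≡.sym m∸n≡) (n∣m*n (m / p ∸ n / p))
    where
    m∸n≡ : m ∸ n ≡ (m / p ∸ n / p) * p
    m∸n≡ = begin
      m ∸ n                                     ≡⟨ cong₂ _∸_ (m≡m%n+[m/n]*n m p) (m≡m%n+[m/n]*n n p) ⟩
      (m % p + m / p * p) ∸ (n % p + n / p * p) ≡⟨ cong (λ r → r + m / p * p ∸ (n % p + n / p * p)) eq ⟩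
      (n % p + m / p * p) ∸ (n % p + n / p * p) ≡⟨ [m+n]∸[m+o]≡n∸o (n % p) _ _ ⟩
      m / p * p ∸ n / p * p                     ≡⟨ *-distribʳ-∸ p (m / p) (n / p) ⟨
      (m / p ∸ n / p) * p                       ∎

  [m+n]%p≡n%p⇒p∣m : ∀ m n → (m + n) % p ≡ n % p → p ∣ m
  [m+n]%p≡n%p⇒p∣m m n eq = subst (p ∣_) (m+n∸n≡m m n) (%≡⇒∣∸ (m + n) n eq)

  +-%-injectiveʳ : ∀ s {u v} → u < p → v < p → (s + u) % p ≡ (s + v) % p → u ≡ v
  +-%-injectiveʳ s u<p v<p eq = ≤-antisym (%≡⇒≤ eq u<p) (%≡⇒≤ (≡.sym eq) v<p)
    where
    %≡⇒≤ : ∀ {u v} → (s + u) % p ≡ (s + v) % p → u < p → u ≤ v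
    %≡⇒≤ {u} {v} eq u<p = m∸n≡0⇒m≤n (∣∧<⇒≡0 p∣u∸v (≤-<-trans (m∸n≤m u v) u<p))
      where
      p∣u∸v : p ∣ u ∸ v
      p∣u∸v = subst (p ∣_) ([m+n]∸[m+o]≡n∸o s u v) (%≡⇒∣∸ (s + u) (s + v) eq)

module ResidueColouring (α β γ : ℕ) .{{_ : NonZero α}} .{{_ : NonZero β}} .{{_ : NonZero γ}}
                        (α≤γ : α ≤ γ) (β≤γ : β ≤ γ) where
  open ≡.≡-Reasoning

  residueSum : ℕ → ℕ
  residueSum k = k % α + k % β + k % γ

  colour : ℕ → Fin γ
  colour k = fromℕ< (m%n<n (residueSum k) γ)

  colour-cong : ∀ {n i j} .{{_ : NonZero n}} → α ∣ n → β ∣ n → γ ∣ n →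
                i % n ≡ j % n → colour i ≡ colour j
  colour-cong {n} {i} {j} α∣n β∣n γ∣n i≡j =
    cong (λ s → fromℕ< (m%n<n s γ)) (cong₂ _+_ (cong₂ _+_ (%-cong α∣n) (%-cong β∣n)) (%-cong γ∣n))
    where
    %-cong : ∀ {q} .{{_ : NonZero q}} → q ∣ n → i % q ≡ j % q
    %-cong {q} q∣n = begin
      i % q      ≡⟨ m∣n⇒o%n%m≡o%m q n i q∣n ⟨
      i % n % q  ≡⟨ cong (_% q) i≡j ⟩
      j % n % q  ≡⟨ m∣n⇒o%n%m≡o%m q n j q∣n ⟩
      j % q      ∎

  colour≡⇒%≡ : ∀ {p i j s} .{{_ : NonZero p}} → p ≤ γ →
               residueSum i ≡ s + i % p → residueSum j ≡ s + j % p →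
               colour i ≡ colour j → i % p ≡ j % p
  colour≡⇒%≡ {p} {i} {j} {s} p≤γ sum-i sum-j i≡j =
    +-%-injectiveʳ s (<-≤-trans (m%n<n i p) p≤γ) (<-≤-trans (m%n<n j p) p≤γ) (begin
      (s + i % p) % γ   ≡⟨ cong (_% γ) sum-i ⟨
      residueSum i % γ  ≡⟨ fromℕ<-injective _ _ _ _ i≡j ⟩
      residueSum j % γ  ≡⟨ cong (_% γ) sum-j ⟩
      (s + j % p) % γ   ∎)

  DividedByAllButOne : ℕ → Set
  DividedByAllButOne d = (¬ α ∣ d × β ∣ d × γ ∣ d)
                       ⊎ (α ∣ d × ¬ β ∣ d × γ ∣ d)
                       ⊎ (α ∣ d × β ∣ d × ¬ γ ∣ d)

  colour-separates : ∀ {d} k → DividedByAllButOne d → colour (d + k) ≢ colour k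
  colour-separates {d} k (inj₁ (α∤d , β∣d , γ∣d)) same-colour =
    α∤d ([m+n]%p≡n%p⇒p∣m d k
      (colour≡⇒%≡ α≤γ sum (+-Props.xy∙z≈yz∙x (k % α) (k % β) (k % γ)) same-colour))
    where
    sum : residueSum (d + k) ≡ k % β + k % γ + (d + k) % α
    sum = ≡.trans (+-Props.xy∙z≈yz∙x ((d + k) % α) ((d + k) % β) ((d + k) % γ))
            (cong (_+ (d + k) % α) (cong₂ _+_ (%-remove-+ˡ k β∣d) (%-remove-+ˡ k γ∣d)))
  colour-separates {d} k (inj₂ (inj₁ (α∣d , β∤d , γ∣d))) same-colour =
    β∤d ([m+n]%p≡n%p⇒p∣m d k
      (colour≡⇒%≡ β≤γ sum (+-Props.xy∙z≈xz∙y (k % α) (k % β) (k % γ)) same-colour))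
    where
    sum : residueSum (d + k) ≡ k % α + k % γ + (d + k) % β
    sum = ≡.trans (+-Props.xy∙z≈xz∙y ((d + k) % α) ((d + k) % β) ((d + k) % γ))
            (cong (_+ (d + k) % β) (cong₂ _+_ (%-remove-+ˡ k α∣d) (%-remove-+ˡ k γ∣d)))
  colour-separates {d} k (inj₂ (inj₂ (α∣d , β∣d , γ∤d))) same-colour =
    γ∤d ([m+n]%p≡n%p⇒p∣m d k (colour≡⇒%≡ ≤-refl sum ≡.refl same-colour))
    where
    sum : residueSum (d + k) ≡ k % α + k % β + (d + k) % γ
    sum = cong (_+ (d + k) % γ) (cong₂ _+_ (%-remove-+ˡ k α∣d) (%-remove-+ˡ k β∣d))

module PowerProperties {c ℓ : Level} (G : Group c ℓ) where
  open Group G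
  open SetoidReasoning setoid
  open import Algebra.Properties.Monoid.Mult monoid using (×-congʳ; ×-homo-+; ×-assocˡ)
    renaming (_×_ to _·_)
  open import Algebra.Properties.Group G using (//-rightDividesʳ; x≈y⇒x∙y⁻¹≈ε)

  pow≈· : ∀ x k → pow G x k ≈ k · x
  pow≈· x zero    = refl
  pow≈· x (suc k) = ∙-congˡ (pow≈· x k)

  pow-cong : ∀ {x y} k → x ≈ y → pow G x k ≈ pow G y k
  pow-cong {x} {y} k x≈y = trans (pow≈· x k) (trans (×-congʳ k x≈y) (sym (pow≈· y k)))

  pow-+ : ∀ x i j → pow G x (i + j) ≈ pow G x i ∙ pow G x j
  pow-+ x i j =
    trans (pow≈· x (i + j)) (trans (×-homo-+ x i j) (sym (∙-cong (pow≈· x i) (pow≈· x j))))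

  pow-* : ∀ x d k → pow G (pow G x d) k ≈ pow G x (k * d)
  pow-* x d k = begin
    pow G (pow G x d) k  ≈⟨ pow≈· (pow G x d) k ⟩
    k · pow G x d        ≈⟨ ×-congʳ k (pow≈· x d) ⟩
    k · (d · x)          ≈⟨ ×-assocˡ x k d ⟩
    (k * d) · x          ≈⟨ pow≈· x (k * d) ⟨
    pow G x (k * d)      ∎

  pow-ε : ∀ k → pow G ε k ≈ ε
  pow-ε zero    = refl
  pow-ε (suc k) = trans (identityˡ _) (pow-ε k)

  pow-∸ : ∀ x {i j} → i ≤ j → pow G x j ∙ pow G x i ⁻¹ ≈ pow G x (j ∸ i)
  pow-∸ x {i} {j} i≤j = begin
    pow G x j ∙ pow G x i ⁻¹                ≈⟨ ∙-congʳ (reflexive (cong (pow G x) (m∸n+n≡m i≤j))) ⟨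
    pow G x (j ∸ i + i) ∙ pow G x i ⁻¹      ≈⟨ ∙-congʳ (pow-+ x (j ∸ i) i) ⟩
    pow G x (j ∸ i) ∙ pow G x i ∙ pow G x i ⁻¹  ≈⟨ //-rightDividesʳ (pow G x i) (pow G x (j ∸ i)) ⟩
    pow G x (j ∸ i)                          ∎

  HasOrder-cong : ∀ {x y m} → x ≈ y → HasOrder G x m → HasOrder G y m
  HasOrder-cong {m = m} x≈y (0<m , xᵐ≈ε , minimal) =
    0<m , trans (pow-cong m (sym x≈y)) xᵐ≈ε ,
    λ k 0<k k<m yᵏ≈ε → minimal k 0<k k<m (trans (pow-cong k x≈y) yᵏ≈ε)

  HasOrder∧pow≈ε⇒≡0 : ∀ {x m k} → HasOrder G x m → k < m → pow G x k ≈ ε → k ≡ 0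
  HasOrder∧pow≈ε⇒≡0 {k = zero} _ _ _ = ≡.refl
  HasOrder∧pow≈ε⇒≡0 {k = suc k} (_ , _ , minimal) k<m xᵏ≈ε
    with () ← minimal (suc k) z<s k<m xᵏ≈ε

  HasOrder⇒≉ : ∀ {x y m} → 1 < m → HasOrder G (x ∙ y ⁻¹) m → ¬ x ≈ y
  HasOrder⇒≉ 1<m ord x≈y
    with () ← HasOrder∧pow≈ε⇒≡0 ord 1<m (trans (identityʳ _) (x≈y⇒x∙y⁻¹≈ε x≈y))

module Order {c ℓ : Level} (G : Group c ℓ) {a : Group.Carrier G} {n : ℕ} (ord : HasOrder G a n) where
  open Group G
  open SetoidReasoning setoid
  open PowerProperties G
  open import Algebra.Properties.Group G using (x≈y⇒x∙y⁻¹≈ε)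

  instance
    n≢0 : NonZero n
    n≢0 = >-nonZero (proj₁ ord)

  ∣⇒pow≈ε : ∀ {j} → n ∣ j → pow G a j ≈ ε
  ∣⇒pow≈ε (divides q ≡.refl) =
    trans (sym (pow-* a n q)) (trans (pow-cong q (proj₁ (proj₂ ord))) (pow-ε q))

  pow≈ε⇒∣ : ∀ j → pow G a j ≈ ε → n ∣ j
  pow≈ε⇒∣ j aʲ≈ε = m%n≡0⇒n∣m j n (HasOrder∧pow≈ε⇒≡0 ord (m%n<n j n) aʳ≈ε)
    where
    aʳ≈ε : pow G a (j % n) ≈ ε
    aʳ≈ε = begin
      pow G a (j % n)                          ≈⟨ identityʳ _ ⟨
      pow G a (j % n) ∙ ε                      ≈⟨ ∙-congˡ (∣⇒pow≈ε (n∣m*n (j / n))) ⟨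
      pow G a (j % n) ∙ pow G a (j / n * n)    ≈⟨ pow-+ a (j % n) (j / n * n) ⟨
      pow G a (j % n + j / n * n)              ≈⟨ reflexive (cong (pow G a) (m≡m%n+[m/n]*n j n)) ⟨
      pow G a j                                ≈⟨ aʲ≈ε ⟩
      ε                                        ∎

  ≤∧pow≈pow⇒%≡ : ∀ {i j} → i ≤ j → pow G a j ≈ pow G a i → j % n ≡ i % n
  ≤∧pow≈pow⇒%≡ {i} {j} i≤j aʲ≈aⁱ =
    ≡.trans (cong (_% n) (≡.sym (m∸n+n≡m i≤j))) (%-remove-+ˡ i n∣j∸i)
    where
    n∣j∸i : n ∣ j ∸ i
    n∣j∸i = pow≈ε⇒∣ (j ∸ i) (trans (sym (pow-∸ a i≤j)) (x≈y⇒x∙y⁻¹≈ε aʲ≈aⁱ))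

  pow≈pow⇒%≡ : ∀ i j → pow G a i ≈ pow G a j → i % n ≡ j % n
  pow≈pow⇒%≡ i j aⁱ≈aʲ with ≤-total i j
  ... | inj₁ i≤j = ≡.sym (≤∧pow≈pow⇒%≡ i≤j (sym aⁱ≈aʲ))
  ... | inj₂ j≤i = ≤∧pow≈pow⇒%≡ j≤i aⁱ≈aʲ

  pow-pow≈ε⇒∣ : ∀ d k → pow G (pow G a d) k ≈ ε → n ∣ k * d
  pow-pow≈ε⇒∣ d k aᵈᵏ≈ε = pow≈ε⇒∣ (k * d) (trans (sym (pow-* a d k)) aᵈᵏ≈ε)

  ∣⇒pow-pow≈ε : ∀ d k → n ∣ k * d → pow G (pow G a d) k ≈ ε
  ∣⇒pow-pow≈ε d k n∣kd = trans (pow-* a d k) (∣⇒pow≈ε n∣kd)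

  pow-hasOrder-square⇒ : ∀ {p q d} → Prime p → n ≡ p * p * q → Coprime p q →
                         HasOrder G (pow G a d) (p * p) → q ∣ d × ¬ p ∣ d
  pow-hasOrder-square⇒ {p} {q} {d} p-prime n≡ppq p⊥q (_ , aᵈᵖᵖ≈ε , minimal) = q∣d , p∤d
    where
    instance
      p≢0 : NonZero p
      p≢0 = prime⇒nonZero p-prime
      p≢1 : NonTrivial p
      p≢1 = prime⇒nonTrivial p-prime
      pp≢0 : NonZero (p * p)
      pp≢0 = m*n≢0 p p
    q∣d : q ∣ d
    q∣d = *-cancelˡ-∣ (p * p) (subst (_∣ p * p * d) n≡ppq (pow-pow≈ε⇒∣ d (p * p) aᵈᵖᵖ≈ε))
    p∤d : ¬ p ∣ d
    p∤d p∣d = minimal p (>-nonZero⁻¹ p) (m<m*n p p (nonTrivial⇒n>1 p)) (∣⇒pow-pow≈ε d p n∣pd)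
      where
      n∣pd : n ∣ p * d
      n∣pd = subst (_∣ p * d) (≡.sym (≡.trans n≡ppq (*-assoc p p q)))
               (*-monoʳ-∣ p (coprime∧∣∧∣⇒*∣ p⊥q p∣d q∣d))

  pow-hasOrder : ∀ {c m e} .{{_ : NonZero c}} .{{_ : NonZero m}} → n ≡ c * m → Coprime m e →
                 HasOrder G (pow G a (c * e)) m
  pow-hasOrder {c} {m} {e} n≡cm m⊥e =
    >-nonZero⁻¹ m , ∣⇒pow-pow≈ε (c * e) m n∣mce , minimal
    where
    n∣mce : n ∣ m * (c * e)
    n∣mce = subst₂ _∣_ (≡.sym n≡cm) (*-Props.xy∙z≈y∙xz c m e) (m∣m*n e)
    minimal : ∀ k → 0 < k → k < m → ¬ pow G (pow G a (c * e)) k ≈ ε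
    minimal k 0<k k<m aᶜᵉᵏ≈ε = <⇒≱ k<m (∣⇒≤ {{>-nonZero 0<k}} m∣k)
      where
      m∣k : m ∣ k
      m∣k = coprime-divisor m⊥e (*-cancelˡ-∣ c
              (subst₂ _∣_ n≡cm (*-Props.x∙yz≈y∙zx k c e) (pow-pow≈ε⇒∣ (c * e) k aᶜᵉᵏ≈ε)))

module CayleyGraph {c ℓ : Level} (G : Group c ℓ) (α β γ : ℕ) where
  open Group G
  open PowerProperties G

  InC-cong : ∀ {x y} → x ≈ y → InC G α β γ x → InC G α β γ y
  InC-cong x≈y = Sum.map (HasOrder-cong x≈y) (Sum.map (HasOrder-cong x≈y) (HasOrder-cong x≈y))

  clique⇒¬colourable : ∀ {m k} (v : Fin m → Carrier) →
                       (∀ {i j} → i Fin.< j → Adj G α β γ (v j) (v i)) →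
                       k < m → ¬ Colourable G α β γ k
  clique⇒¬colourable v adjacent k<m (colour , _ , proper)
    with i , j , i<j , same-colour ← pigeonhole k<m (colour ∘ v)
    = proper (v j) (v i) (adjacent i<j) (≡.sym same-colour)

  module _ {a : Carrier} {n : ℕ} (cyclic : IsCyclicOfOrderWithGenerator G a n) where
    open SetoidReasoning setoid
    open Order G (proj₁ cyclic)
    open import Algebra.Properties.Group G using (//-rightDividesˡ)

    log : Carrier → ℕ
    log x = proj₁ (proj₂ cyclic x)

    pow-log : ∀ x → pow G a (log x) ≈ x
    pow-log x = sym (proj₂ (proj₂ cyclic x))

    log-∙⁻¹ : ∀ x y → log x % n ≡ (log (x ∙ y ⁻¹) + log y) % n
    log-∙⁻¹ x y = pow≈pow⇒%≡ _ _ (begin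
      pow G a (log x)                          ≈⟨ pow-log x ⟩
      x                                        ≈⟨ //-rightDividesˡ y x ⟨
      x ∙ y ⁻¹ ∙ y                             ≈⟨ ∙-cong (pow-log (x ∙ y ⁻¹)) (pow-log y) ⟨
      pow G a (log (x ∙ y ⁻¹)) ∙ pow G a (log y) ≈⟨ pow-+ a (log (x ∙ y ⁻¹)) (log y) ⟨
      pow G a (log (x ∙ y ⁻¹) + log y)         ∎)

    exponentColouring⇒colourable : ∀ {k} (f : ℕ → Fin k) →
      (∀ {i j} → i % n ≡ j % n → f i ≡ f j) →
      (∀ {d} j → InC G α β γ (pow G a d) → f (d + j) ≢ f j) →
      Colourable G α β γ k
    exponentColouring⇒colourable f f-cong separates = f ∘ log , respects , proper
      where
      respects : ∀ x y → x ≈ y → f (log x) ≡ f (log y)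
      respects x y x≈y =
        f-cong (pow≈pow⇒%≡ _ _ (trans (pow-log x) (trans x≈y (sym (pow-log y)))))
      proper : ∀ x y → Adj G α β γ x y → f (log x) ≢ f (log y)
      proper x y (_ , x/y∈C) same-colour =
        separates (log y) (InC-cong (sym (pow-log (x ∙ y ⁻¹))) x/y∈C)
          (≡.trans (f-cong (≡.sym (log-∙⁻¹ x y))) same-colour)

module Proposition2p8 {c ℓ : Level} (α β γ : ℕ)
                      (α-prime : Prime α) (β-prime : Prime β) (γ-prime : Prime γ)
                      (α<β : α < β) (β<γ : β < γ) (G : Group c ℓ) (a : Group.Carrier G)
                      (cyclic : IsCyclicOfOrderWithGenerator G a (α * α * (β * β) * (γ * γ))) where
  open Group G
  open PowerProperties G
  open Order G (proj₁ cyclic)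
  open CayleyGraph G α β γ

  instance
    α≢0 : NonZero α
    α≢0 = prime⇒nonZero α-prime
    β≢0 : NonZero β
    β≢0 = prime⇒nonZero β-prime
    γ≢0 : NonZero γ
    γ≢0 = prime⇒nonZero γ-prime
    γγ≢0 : NonZero (γ * γ)
    γγ≢0 = m*n≢0 γ γ
    ααββ≢0 : NonZero (α * α * (β * β))
    ααββ≢0 = m*n≢0 (α * α) (β * β) {{m*n≢0 α α}} {{m*n≢0 β β}}

  α<γ : α < γ
  α<γ = <-trans α<β β<γ

  1<γ : 1 < γ
  1<γ = nonTrivial⇒n>1 γ {{prime⇒nonTrivial γ-prime}}

  open ResidueColouring α β γ (<⇒≤ α<γ) (<⇒≤ β<γ)

  pow∈C⇒dividedByAllButOne : ∀ {d} → InC G α β γ (pow G a d) → DividedByAllButOne d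
  pow∈C⇒dividedByAllButOne (inj₁ ord)
    with ββγγ∣d , α∤d ← pow-hasOrder-square⇒ α-prime (*-assoc (α * α) (β * β) (γ * γ))
                          (coprime-squares (Coprimality.sym (prime⇒coprime β-prime α<β))
                                           (Coprimality.sym (prime⇒coprime γ-prime α<γ))) ord
    = inj₁ (α∤d , square-factors∣ ββγγ∣d)
  pow∈C⇒dividedByAllButOne (inj₂ (inj₁ ord))
    with ααγγ∣d , β∤d ← pow-hasOrder-square⇒ β-prime (*-Props.xy∙z≈y∙xz (α * α) (β * β) (γ * γ))
                          (coprime-squares (prime⇒coprime β-prime α<β)
                                           (Coprimality.sym (prime⇒coprime γ-prime β<γ))) ord
    with α∣d , γ∣d ← square-factors∣ ααγγ∣d
    = inj₂ (inj₁ (α∣d , β∤d , γ∣d))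
  pow∈C⇒dividedByAllButOne (inj₂ (inj₂ ord))
    with ααββ∣d , γ∤d ← pow-hasOrder-square⇒ γ-prime (*-comm (α * α * (β * β)) (γ * γ))
                          (coprime-squares (prime⇒coprime γ-prime α<γ)
                                           (prime⇒coprime γ-prime β<γ)) ord
    with α∣d , β∣d ← square-factors∣ ααββ∣d
    = inj₂ (inj₂ (α∣d , β∣d , γ∤d))

  colourable : Colourable G α β γ γ
  colourable = exponentColouring⇒colourable cyclic colour
    (colour-cong (∣m⇒∣m*n (γ * γ) (∣m⇒∣m*n (β * β) (m∣m*n α)))
                 (∣m⇒∣m*n (γ * γ) (∣n⇒∣m*n (α * α) (m∣m*n β)))
                 (∣n⇒∣m*n (α * α * (β * β)) (m∣m*n γ)))
    (λ k aᵈ∈C → colour-separates k (pow∈C⇒dividedByAllButOne aᵈ∈C))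

  not-colourable : ∀ k → k < γ → ¬ Colourable G α β γ k
  not-colourable k k<γ = clique⇒¬colourable v adjacent k<γ
    where
    v : Fin γ → Carrier
    v i = pow G a (α * α * (β * β) * toℕ i)
    adjacent : ∀ {i j} → i Fin.< j → Adj G α β γ (v j) (v i)
    adjacent {i} {j} i<j = HasOrder⇒≉ (<-trans 1<γ (m<m*n γ γ 1<γ)) ord , inj₂ (inj₂ ord)
      where
      instance
        j∸i≢0 : NonZero (toℕ j ∸ toℕ i)
        j∸i≢0 = >-nonZero (m<n⇒0<n∸m i<j)
      j∸i<γ : toℕ j ∸ toℕ i < γ
      j∸i<γ = ≤-<-trans (m∸n≤m (toℕ j) (toℕ i)) (toℕ<n j)
      v[j]∙v[i]⁻¹≈ : v j ∙ v i ⁻¹ ≈ pow G a (α * α * (β * β) * (toℕ j ∸ toℕ i))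
      v[j]∙v[i]⁻¹≈ = trans (pow-∸ a (*-monoʳ-≤ (α * α * (β * β)) (<⇒≤ i<j)))
        (reflexive (cong (pow G a) (≡.sym (*-distribˡ-∸ (α * α * (β * β)) (toℕ j) (toℕ i)))))
      ord : HasOrder G (v j ∙ v i ⁻¹) (γ * γ)
      ord = HasOrder-cong (sym v[j]∙v[i]⁻¹≈)
              (pow-hasOrder ≡.refl (prime⇒coprime-square γ-prime j∸i<γ))

proposition2p8 : {c ℓ : Level} (α β γ : ℕ) → Prime α → Prime β → Prime γ → α < β → β < γ →
    (G : Group c ℓ) (a : Group.Carrier G) →
    IsCyclicOfOrderWithGenerator G a (α * α * (β * β) * (γ * γ)) →
    ChromaticNumberIs G α β γ γ
proposition2p8 α β γ α-prime β-prime γ-prime α<β β<γ G a cyclic = colourable , not-colourable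
  where open Proposition2p8 α β γ α-prime β-prime γ-prime α<β β<γ G a cyclic
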